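{- Let $q$ be a prime power and $\alpha$ a primitive element of $\mathbb{F}_{q^5}$ (identified with $\mathbb{F}_q^5$). Then the $2$-dimensional subspaces $\langle\alpha^0,\alpha^1\rangle$ and $\langle\alpha^0,\alpha^2\rangle$ lie in different equivalence classes of $E_2$.
   Context: $\langle v_1,\ldots,v_m\rangle$ denotes the $\mathbb{F}_q$-linear span. For a subspace $X$ and nonzero $\beta\in\mathbb{F}_{q^5}$, $\beta X=\{\beta x:x\in X\}$. $E_2$ is the equivalence relation on $2$-dimensional subspaces of $\mathbb{F}_q^5$ given by $(X,Y)\in E_2$ iff $Y=\alpha^jX$ for some integer $j$. -}

module Defs where

open import Level using (0ℓ)
open import Algebra.Bundles using (CommutativeRing)
open import Data.Nat using (ℕ; zero; suc)
open import Data.Integer using (ℤ; +_; -[1+_])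
open import Data.Fin using (Fin)
open import Data.Vec using (Vec; lookup)
open import Data.Product using (Σ; ∃; _×_; _,_)
open import Relation.Nullary using (¬_)
open import Relation.Binary.PropositionalEquality using (_≡_)

Pred : Set → Set₁
Pred A = A → Set

module FieldDefs (K : CommutativeRing 0ℓ 0ℓ) where
  open CommutativeRing K

  -- field structure on a commutative ring (stdlib has no Field bundle)
  record IsField : Set where
    field
      inv       : Carrier → Carrier
      1≉0       : ¬ (1# ≈ 0#)
      inverseʳ  : ∀ x → ¬ (x ≈ 0#) → (x * inv x) ≈ 1#

  pow : Carrier → ℕ → Carrier
  pow x zero    = 1#
  pow x (suc n) = x * pow x n

  zpow : IsField → Carrier → ℤ → Carrier
  zpow F x (+ n)     = pow x n
  zpow F x -[1+ n ]  = pow (IsField.inv F x) (suc n)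

  ElemOf : ∀ {n} → Vec Carrier n → Pred Carrier
  ElemOf {n} v x = ∃ λ (i : Fin n) → x ≈ lookup v i

  Distinct : ∀ {n} → Vec Carrier n → Set
  Distinct {n} v = ∀ (i j : Fin n) → lookup v i ≈ lookup v j → i ≡ j

  HasCard : ℕ → Set
  HasCard n = Σ (Vec Carrier n) λ v → Distinct v × (∀ x → ElemOf v x)

  record IsSubfield (F : IsField) (S : Pred Carrier) : Set where
    field
      resp  : ∀ {x y} → x ≈ y → S x → S y
      has0  : S 0#
      has1  : S 1#
      +-cl  : ∀ {x y} → S x → S y → S (x + y)
      neg-cl : ∀ {x} → S x → S (- x)
      *-cl  : ∀ {x y} → S x → S y → S (x * y)
      inv-cl : ∀ {x} → S x → ¬ (x ≈ 0#) → S (IsField.inv F x)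

  record SubfieldOfSize (F : IsField) (q : ℕ) : Set where
    field
      elems    : Vec Carrier q
      distinct : Distinct elems
      subfield : IsSubfield F (ElemOf elems)

  IsPrimitive : Carrier → Set
  IsPrimitive α = ¬ (α ≈ 0#) × (∀ x → ¬ (x ≈ 0#) → ∃ λ (n : ℕ) → x ≈ pow α n)

  Span2 : Pred Carrier → Carrier → Carrier → Pred Carrier
  Span2 S v₁ v₂ x = ∃ λ a → ∃ λ b → S a × S b × (x ≈ ((a * v₁) + (b * v₂)))

  Scale : Carrier → Pred Carrier → Pred Carrier
  Scale β X y = ∃ λ x → X x × (y ≈ (β * x))

  SameSet : Pred Carrier → Pred Carrier → Set
  SameSet X Y = ∀ x → (X x → Y x) × (Y x → X x)

  E₂ : IsField → Carrier → Pred Carrier → Pred Carrier → Set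
  E₂ F α X Y = ∃ λ (j : ℤ) → SameSet Y (Scale (zpow F α j) X)

module Submission where

-- Suppose ⟨1, α²⟩ = β ⟨1, α⟩ for some β = α^j.  Since
-- 1 and α² lie in ⟨1, α²⟩ we get 1 = β u and α² = β v with u, v ∈ ⟨1, α⟩, so
-- α² u = v with u ≠ 0.  Writing u = a + bα and v = c + dα, either b ≠ 0 and
-- α³ = b⁻¹(c + dα − aα²), or b = 0, a ≠ 0 and α³ = a⁻¹(cα + dα²).  In both
-- cases α³ ∈ ⟨1, α, α²⟩, so this span is stable under multiplication by α,
-- hence contains every power of α and therefore (α being primitive) all of K.
-- Counting coefficient triples then gives q⁵ ≤ q³, impossible since q ≥ 2.

open import Defs
open import Level using (0ℓ)
open import Algebra.Bundles using (CommutativeRing)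
open import Data.Nat using (ℕ; suc; _^_)
open import Data.Nat.Primality using (Prime)
open import Relation.Nullary using (¬_)
open import Relation.Binary.PropositionalEquality using (_≡_)

open import Data.Nat as ℕ using (zero; _≤_; _<_; z≤n; s≤s)
import Data.Nat.Properties as ℕP
open import Data.Fin as Fin using (Fin; combine)
import Data.Fin.Properties as FinP
open import Data.Vec using (lookup)
open import Data.Product using (∃; _×_; _,_; proj₁; proj₂)
open import Relation.Nullary using (Dec; yes; no; contradiction)
open import Relation.Binary.Definitions using (Decidable)
import Relation.Binary.PropositionalEquality as Eq

cube<fifth : ∀ q → 2 ≤ q → q ℕ.* (q ℕ.* q) < q ^ 5
cube<fifth q 2≤q = Eq.subst (_< q ^ 5) (Eq.cong (λ t → q ℕ.* (q ℕ.* t)) (ℕP.*-identityʳ q))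
  (ℕP.^-monoʳ-< q 2≤q {3} {5} (s≤s (s≤s (s≤s (s≤s z≤n)))))

two-positions⇒2≤ : ∀ {m} (i j : Fin m) → ¬ i ≡ j → 2 ≤ m
two-positions⇒2≤ {suc zero}    Fin.zero Fin.zero i≢j = contradiction Eq.refl i≢j
two-positions⇒2≤ {suc (suc _)} _        _        _   = s≤s (s≤s z≤n)

module FiniteField (K : CommutativeRing 0ℓ 0ℓ) (F : FieldDefs.IsField K)
                   {n : ℕ} (card : FieldDefs.HasCard K n) where

  open CommutativeRing K
  open FieldDefs K
  open IsField F
  open import Relation.Binary.Reasoning.Setoid setoid

  private
    listing = proj₁ card
    listing-distinct = proj₁ (proj₂ card)
    listing-covers = proj₂ (proj₂ card)

  -- Equality in a finite ring is decidable: compare the positions of the two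
  -- elements in the exhaustive listing of distinct elements.
  _≈?_ : Decidable _≈_
  x ≈? y with listing-covers x | listing-covers y
  ... | i , x≈i | j , y≈j with i Fin.≟ j
  ... | yes Eq.refl = yes (trans x≈i (sym y≈j))
  ... | no i≢j = no λ x≈y → i≢j (listing-distinct i j (trans (sym x≈i) (trans x≈y y≈j)))

  open import Algebra.Solver.Ring.NaturalCoefficients.Default commutativeSemiring

  -- A subfield of size q contains the distinct elements 0 and 1, so q ≥ 2.
  subfield-size≥2 : ∀ {q} → SubfieldOfSize F q → 2 ≤ q
  subfield-size≥2 Fq with IsSubfield.has0 subfield | IsSubfield.has1 subfield
    where open SubfieldOfSize Fq
  ... | i , 0≈i | j , 1≈j = two-positions⇒2≤ i j λ { Eq.refl → 1≉0 (trans 1≈j (sym 0≈i)) }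

  generator₁∈span : ∀ {S} → IsSubfield F S → ∀ v w → Span2 S v w v
  generator₁∈span sub v w = 1# , 0# , IsSubfield.has1 sub , IsSubfield.has0 sub ,
    solve 2 (λ v w → v := con 1 :* v :+ con 0 :* w) refl v w

  generator₂∈span : ∀ {S} → IsSubfield F S → ∀ v w → Span2 S v w w
  generator₂∈span sub v w = 0# , 1# , IsSubfield.has0 sub , IsSubfield.has1 sub ,
    solve 2 (λ v w → w := con 0 :* v :+ con 1 :* w) refl v w

  Shifts : Carrier → Pred Carrier → Set
  Shifts γ X = ∃ λ u → ∃ λ v → X u × X v × ¬ (u ≈ 0#) × γ * u ≈ v

  -- If Y = βX and Y contains 1 and γ, then γ shifts X: writing 1 = βu and
  -- γ = βv we get γu = v(βu) = v, and u ≠ 0.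
  shift-relation : ∀ {β : Carrier} {X Y : Pred Carrier} {γ : Carrier} →
    SameSet Y (Scale β X) → Y 1# → Y γ → Shifts γ X
  shift-relation {β} {γ = γ} Y≡βX 1∈Y γ∈Y
    with proj₁ (Y≡βX 1#) 1∈Y | proj₁ (Y≡βX γ) γ∈Y
  ... | u , u∈X , 1≈βu | v , v∈X , γ≈βv = u , v , u∈X , v∈X , u≉0 , γu≈v
    where
    u≉0 : ¬ (u ≈ 0#)
    u≉0 u≈0 = 1≉0 (trans 1≈βu (trans (*-congˡ u≈0) (zeroʳ β)))
    γu≈v : γ * u ≈ v
    γu≈v = begin
      γ * u        ≈⟨ *-congʳ γ≈βv ⟩
      (β * v) * u  ≈⟨ solve 3 (λ β v u → (β :* v) :* u := v :* (β :* u)) refl β v u ⟩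
      v * (β * u)  ≈⟨ *-congˡ (sym 1≈βu) ⟩
      v * 1#       ≈⟨ *-identityʳ v ⟩
      v            ∎

  module Powers (S : Pred Carrier) (sub : IsSubfield F S) (α : Carrier) where
    open IsSubfield sub

    Deg≤2 : Pred Carrier
    Deg≤2 z = ∃ λ a → ∃ λ b → ∃ λ c → S a × S b × S c × z ≈ a + b * α + c * (α * α)

    deg≤2-resp : ∀ {x y} → x ≈ y → Deg≤2 x → Deg≤2 y
    deg≤2-resp x≈y (a , b , c , sa , sb , sc , x≈) = a , b , c , sa , sb , sc , trans (sym x≈y) x≈

    deg≤2-0 : Deg≤2 0#
    deg≤2-0 = 0# , 0# , 0# , has0 , has0 , has0 ,
      solve 1 (λ α → con 0 := con 0 :+ con 0 :* α :+ con 0 :* (α :* α)) refl α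

    deg≤2-1 : Deg≤2 1#
    deg≤2-1 = 1# , 0# , 0# , has1 , has0 , has0 ,
      solve 1 (λ α → con 1 := con 1 :+ con 0 :* α :+ con 0 :* (α :* α)) refl α

    -- Once α³ has degree ≤ 2, multiplication by α preserves degree ≤ 2:
    -- α(a + bα + cα²) = aα + bα² + c(e + fα + gα²).
    deg≤2-α* : Deg≤2 (α * (α * α)) → ∀ {z} → Deg≤2 z → Deg≤2 (α * z)
    deg≤2-α* (e , f , g , se , sf , sg , α³≈) {z} (a , b , c , sa , sb , sc , z≈) =
      c * e , a + c * f , b + c * g ,
      *-cl sc se , +-cl sa (*-cl sc sf) , +-cl sb (*-cl sc sg) ,
      (begin
        α * z                                              ≈⟨ *-congˡ z≈ ⟩
        α * (a + b * α + c * (α * α))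
          ≈⟨ solve 4 (λ α a b c → α :* (a :+ b :* α :+ c :* (α :* α))
                    := a :* α :+ b :* (α :* α) :+ c :* (α :* (α :* α))) refl α a b c ⟩
        a * α + b * (α * α) + c * (α * (α * α))            ≈⟨ +-congˡ (*-congˡ α³≈) ⟩
        a * α + b * (α * α) + c * (e + f * α + g * (α * α))
          ≈⟨ solve 7 (λ α a b c e f g → a :* α :+ b :* (α :* α) :+ c :* (e :+ f :* α :+ g :* (α :* α))
                    := c :* e :+ (a :+ c :* f) :* α :+ (b :+ c :* g) :* (α :* α)) refl α a b c e f g ⟩
        c * e + (a + c * f) * α + (b + c * g) * (α * α)    ∎)

    -- Hence every power of α, and so (for α primitive) every element of K,
    -- has degree ≤ 2.
    deg≤2-everything : Deg≤2 (α * (α * α)) → IsPrimitive α → ∀ z → Deg≤2 z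
    deg≤2-everything α³∈ (_ , generates) z with z ≈? 0#
    ... | yes z≈0 = deg≤2-resp (sym z≈0) deg≤2-0
    ... | no z≉0 = deg≤2-resp (sym z≈αᵏ) (deg≤2-pow k)
      where
      k = proj₁ (generates z z≉0)
      z≈αᵏ = proj₂ (generates z z≉0)
      deg≤2-pow : ∀ m → Deg≤2 (pow α m)
      deg≤2-pow zero    = deg≤2-1
      deg≤2-pow (suc m) = deg≤2-α* α³∈ (deg≤2-pow m)

    -- A cubic relation α²(a + bα) = c + dα with b ≠ 0 gives α³ degree ≤ 2:
    -- α³ = b⁻¹c + b⁻¹d α + b⁻¹(−a) α².
    cube-from-cubic : ∀ {a b c d} → S a → S b → S c → S d → ¬ (b ≈ 0#) →
      (α * α) * (a + b * α) ≈ c + d * α → Deg≤2 (α * (α * α))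
    cube-from-cubic {a} {b} {c} {d} sa sb sc sd b≉0 relation =
      b⁻¹ * c , b⁻¹ * d , b⁻¹ * (- a) ,
      *-cl sb⁻¹ sc , *-cl sb⁻¹ sd , *-cl sb⁻¹ (neg-cl sa) ,
      (begin
        α * (α * α)                 ≈⟨ sym (*-identityˡ _) ⟩
        1# * (α * (α * α))          ≈⟨ *-congʳ (sym (inverseʳ b b≉0)) ⟩
        (b * b⁻¹) * (α * (α * α))
          ≈⟨ solve 3 (λ α b b⁻¹ → (b :* b⁻¹) :* (α :* (α :* α))
                    := (b :* b⁻¹) :* (α :* (α :* α)) :+ b⁻¹ :* con 0 :* (α :* α)) refl α b b⁻¹ ⟩
        (b * b⁻¹) * (α * (α * α)) + b⁻¹ * 0# * (α * α)
          ≈⟨ +-congˡ (*-congʳ (*-congˡ (sym (-‿inverseʳ a)))) ⟩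
        (b * b⁻¹) * (α * (α * α)) + b⁻¹ * (a + - a) * (α * α)
          ≈⟨ solve 5 (λ α a na b b⁻¹ → (b :* b⁻¹) :* (α :* (α :* α)) :+ b⁻¹ :* (a :+ na) :* (α :* α)
                    := b⁻¹ :* ((α :* α) :* (a :+ b :* α)) :+ b⁻¹ :* na :* (α :* α)) refl α a (- a) b b⁻¹ ⟩
        b⁻¹ * ((α * α) * (a + b * α)) + b⁻¹ * (- a) * (α * α)
          ≈⟨ +-congʳ (*-congˡ relation) ⟩
        b⁻¹ * (c + d * α) + b⁻¹ * (- a) * (α * α)
          ≈⟨ solve 5 (λ α na b⁻¹ c d → b⁻¹ :* (c :+ d :* α) :+ b⁻¹ :* na :* (α :* α)
                    := b⁻¹ :* c :+ b⁻¹ :* d :* α :+ b⁻¹ :* na :* (α :* α)) refl α (- a) b⁻¹ c d ⟩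
        b⁻¹ * c + b⁻¹ * d * α + b⁻¹ * (- a) * (α * α) ∎)
      where
      b⁻¹ = inv b
      sb⁻¹ = inv-cl sb b≉0

    -- A quadratic relation aα² = c + dα with a ≠ 0 gives α³ degree ≤ 2:
    -- α³ = a⁻¹α(c + dα) = a⁻¹c α + a⁻¹d α².
    cube-from-quadratic : ∀ {a c d} → S a → S c → S d → ¬ (a ≈ 0#) →
      a * (α * α) ≈ c + d * α → Deg≤2 (α * (α * α))
    cube-from-quadratic {a} {c} {d} sa sc sd a≉0 relation =
      0# , a⁻¹ * c , a⁻¹ * d ,
      has0 , *-cl sa⁻¹ sc , *-cl sa⁻¹ sd ,
      (begin
        α * (α * α)                 ≈⟨ sym (*-identityˡ _) ⟩
        1# * (α * (α * α))          ≈⟨ *-congʳ (sym (inverseʳ a a≉0)) ⟩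
        (a * a⁻¹) * (α * (α * α))
          ≈⟨ solve 3 (λ α a a⁻¹ → (a :* a⁻¹) :* (α :* (α :* α)) := a⁻¹ :* α :* (a :* (α :* α))) refl α a a⁻¹ ⟩
        a⁻¹ * α * (a * (α * α))     ≈⟨ *-congˡ relation ⟩
        a⁻¹ * α * (c + d * α)
          ≈⟨ solve 4 (λ α a⁻¹ c d → a⁻¹ :* α :* (c :+ d :* α)
                    := con 0 :+ a⁻¹ :* c :* α :+ a⁻¹ :* d :* (α :* α)) refl α a⁻¹ c d ⟩
        0# + a⁻¹ * c * α + a⁻¹ * d * (α * α) ∎)
      where
      a⁻¹ = inv a
      sa⁻¹ = inv-cl sa a≉0

    -- If α² shifts ⟨1, α⟩, i.e. α²(a + bα) = c + dα with a + bα ≠ 0, then α³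
    -- has degree ≤ 2: use the cubic relation if b ≠ 0, and otherwise the
    -- quadratic relation aα² = c + dα, where a ≠ 0.
    cube-from-shift : Shifts (pow α 2) (Span2 S (pow α 0) (pow α 1)) → Deg≤2 (α * (α * α))
    cube-from-shift (u , v , (a , b , sa , sb , u≈) , (c , d , sc , sd , v≈) , u≉0 , α²u≈v) =
      by-leading-coefficient (b ≈? 0#) (a ≈? 0#)
      where
      relation : (α * α) * (a + b * α) ≈ c + d * α
      relation = begin
        (α * α) * (a + b * α)       ≈⟨ solve 3 (λ α a b → (α :* α) :* (a :+ b :* α)
                                         := (α :* (α :* con 1)) :* (a :* con 1 :+ b :* (α :* con 1))) refl α a b ⟩
        pow α 2 * (a * 1# + b * (α * 1#)) ≈⟨ *-congˡ (sym u≈) ⟩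
        pow α 2 * u                 ≈⟨ α²u≈v ⟩
        v                           ≈⟨ v≈ ⟩
        c * 1# + d * (α * 1#)       ≈⟨ solve 3 (λ α c d → c :* con 1 :+ d :* (α :* con 1) := c :+ d :* α) refl α c d ⟩
        c + d * α                   ∎

      by-leading-coefficient : Dec (b ≈ 0#) → Dec (a ≈ 0#) → Deg≤2 (α * (α * α))
      by-leading-coefficient (no b≉0) _ = cube-from-cubic sa sb sc sd b≉0 relation
      by-leading-coefficient (yes b≈0) (no a≉0) = cube-from-quadratic sa sc sd a≉0 (begin
        a * (α * α)                 ≈⟨ solve 2 (λ α a → a :* (α :* α) := (α :* α) :* (a :+ con 0 :* α)) refl α a ⟩
        (α * α) * (a + 0# * α)      ≈⟨ *-congˡ (+-congˡ (*-congʳ (sym b≈0))) ⟩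
        (α * α) * (a + b * α)       ≈⟨ relation ⟩
        c + d * α                   ∎)
      by-leading-coefficient (yes b≈0) (yes a≈0) = contradiction (begin
        u                           ≈⟨ u≈ ⟩
        a * 1# + b * (α * 1#)       ≈⟨ +-cong (*-congʳ a≈0) (*-congʳ b≈0) ⟩
        0# * 1# + 0# * (α * 1#)     ≈⟨ solve 1 (λ α → con 0 :* con 1 :+ con 0 :* (α :* con 1) := con 0) refl α ⟩
        0#                          ∎) u≉0

  -- Counting: if every element of K has degree ≤ 2 in α over a subfield of
  -- size q, then the coefficient triple determines the element, so n ≤ q³.
  card-bound : ∀ {q} (Fq : SubfieldOfSize F q) (α : Carrier) →
    let open Powers (ElemOf (SubfieldOfSize.elems Fq)) (SubfieldOfSize.subfield Fq) α in
    (∀ z → Deg≤2 z) → n ≤ q ℕ.* (q ℕ.* q)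
  card-bound {q} Fq α all-deg≤2 = FinP.injective⇒≤ {f = coordinates} coordinates-injective
    where
    open SubfieldOfSize Fq
    open Powers (ElemOf elems) subfield α

    Triple = Fin q × Fin q × Fin q

    element : Triple → Carrier
    element (i , j , k) = lookup elems i + lookup elems j * α + lookup elems k * (α * α)

    position : ∀ z → ∃ λ t → z ≈ element t
    position z with all-deg≤2 z
    ... | _ , _ , _ , (i , a≈) , (j , b≈) , (k , c≈) , z≈ =
      (i , j , k) , trans z≈ (+-cong (+-cong a≈ (*-congʳ b≈)) (*-congʳ c≈))

    encode : Triple → Fin (q ℕ.* (q ℕ.* q))
    encode (i , j , k) = combine i (combine j k)

    encode-injective : ∀ {s t} → encode s ≡ encode t → s ≡ t
    encode-injective {i , j , k} {i′ , j′ , k′} same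
      with FinP.combine-injective i _ i′ _ same
    ... | Eq.refl , jk≡ with FinP.combine-injective j k j′ k′ jk≡
    ... | Eq.refl , Eq.refl = Eq.refl

    coordinates : Fin n → Fin (q ℕ.* (q ℕ.* q))
    coordinates x = encode (proj₁ (position (lookup listing x)))

    coordinates-injective : ∀ {x y} → coordinates x ≡ coordinates y → x ≡ y
    coordinates-injective {x} {y} same = listing-distinct x y (begin
      lookup listing x                             ≈⟨ proj₂ (position (lookup listing x)) ⟩
      element (proj₁ (position (lookup listing x))) ≡⟨ Eq.cong element (encode-injective same) ⟩
      element (proj₁ (position (lookup listing y))) ≈⟨ proj₂ (position (lookup listing y)) ⟨
      lookup listing y                             ∎)

lemma14 : (p k q : ℕ) → Prime p → q ≡ p ^ suc k →
    (K : CommutativeRing 0ℓ 0ℓ) → (F : FieldDefs.IsField K) →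
    FieldDefs.HasCard K (q ^ 5) →
    (Fq : FieldDefs.SubfieldOfSize K F q) →
    (α : CommutativeRing.Carrier K) → FieldDefs.IsPrimitive K α →
    ¬ FieldDefs.E₂ K F α
    (FieldDefs.Span2 K (FieldDefs.ElemOf K (FieldDefs.SubfieldOfSize.elems Fq)) (FieldDefs.pow K α 0) (FieldDefs.pow K α 1))
    (FieldDefs.Span2 K (FieldDefs.ElemOf K (FieldDefs.SubfieldOfSize.elems Fq)) (FieldDefs.pow K α 0) (FieldDefs.pow K α 2))
lemma14 p k q _ _ K F card Fq α α-primitive (_ , Y≡βX) =
  ℕP.<⇒≱ (cube<fifth q (subfield-size≥2 Fq))
         (card-bound Fq α (deg≤2-everything α³-deg≤2 α-primitive))
  where
  open FiniteField K F card
  open CommutativeRing K using (_*_)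
  open FieldDefs K using (pow)
  open FieldDefs.SubfieldOfSize Fq using (elems; subfield)
  open Powers (FieldDefs.ElemOf K elems) subfield α

  -- 1 and α² lie in ⟨1, α²⟩ = β⟨1, α⟩, so α² shifts ⟨1, α⟩, forcing deg α ≤ 3.
  α³-deg≤2 : Deg≤2 (α * (α * α))
  α³-deg≤2 = cube-from-shift (shift-relation Y≡βX
    (generator₁∈span subfield (pow α 0) (pow α 2)) (generator₂∈span subfield (pow α 0) (pow α 2)))
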